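{- For every sufficiently small real $\gamma>0$ (in particular $\gamma<1/6$) there exists $n_0$ such that the following holds. Let $D$ be a digraph on $n\geq n_0$ vertices with $\delta^0(D)\geq(2/3+\gamma)n$. Then for every two disjoint arcs $ab$ and $cd$ of $D$ there is a reverse square $k$-path in $D$ with $k\leq 4/\gamma$ whose first end-arc is $ab$ and whose last end-arc is $cd$.
   Context: Digraphs have no loops and no parallel arcs; $\delta^0(D)$ is the minimum over all vertices of the minimum of the in-degree and out-degree. A reverse square $k$-path is a sequence $v_1v_2\cdots v_k$ of $k$ distinct vertices such that $v_iv_{i+1}\in A(D)$ for all $1\le i\le k-1$ and $v_{i+2}v_i\in A(D)$ for all $1\le i\le k-2$. Its first end-arc is $v_1v_2$ and its last end-arc is $v_{k-1}v_k$.
   Formalization: The parameter γ ranges over the positive rationals instead of the positive reals. -}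

module Defs where

open import Data.Nat using (ℕ; zero; suc)
open import Data.Bool using (Bool; true; false)
open import Data.Fin using (Fin)
open import Data.List using (List; []; _∷_; _++_; length)
open import Data.List.Relation.Unary.Unique.Propositional using (Unique)
open import Data.Product using (_×_; ∃)
open import Data.Unit using (⊤)
open import Relation.Binary.PropositionalEquality using (_≡_; _≢_)
import Data.Integer as ℤ
open import Data.Rational using (ℚ; _/_)

-- A digraph on the vertex set Fin n: a Boolean adjacency relation with no
-- loops.  (No parallel arcs is automatic for a relation.)
record Digraph (n : ℕ) : Set where
  field
    adj      : Fin n → Fin n → Bool
    loopless : ∀ v → adj v v ≡ false

open Digraph public

Arc : ∀ {n} → Digraph n → Fin n → Fin n → Set
Arc D u v = adj D u v ≡ true

countᵇ : ∀ {A : Set} → (A → Bool) → List A → ℕ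
countᵇ p [] = zero
countᵇ p (x ∷ xs) with p x
... | true  = suc (countᵇ p xs)
... | false = countᵇ p xs

allV : (n : ℕ) → List (Fin n)
allV n = Data.List.allFin n
  where import Data.List

outdeg : ∀ {n} → Digraph n → Fin n → ℕ
outdeg {n} D v = countᵇ (λ w → adj D v w) (allV n)

indeg : ∀ {n} → Digraph n → Fin n → ℕ
indeg {n} D v = countᵇ (λ w → adj D w v) (allV n)

ℕ→ℚ : ℕ → ℚ
ℕ→ℚ m = ℤ.+ m / 1

-- "δ⁰(D) ≥ x": every vertex has in- and out-degree at least x
-- (δ⁰(D) = min over vertices of min(indeg, outdeg), unfolded)
δ⁰≥ : ∀ {n} → Digraph n → ℚ → Set
δ⁰≥ {n} D x = ∀ (v : Fin n) →
  (x Data.Rational.≤ ℕ→ℚ (outdeg D v)) × (x Data.Rational.≤ ℕ→ℚ (indeg D v))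

ForwardArcs : ∀ {n} → Digraph n → List (Fin n) → Set
ForwardArcs D [] = ⊤
ForwardArcs D (x ∷ []) = ⊤
ForwardArcs D (x ∷ y ∷ rest) = Arc D x y × ForwardArcs D (y ∷ rest)

BackArcs : ∀ {n} → Digraph n → List (Fin n) → Set
BackArcs D [] = ⊤
BackArcs D (x ∷ []) = ⊤
BackArcs D (x ∷ y ∷ []) = ⊤
BackArcs D (x ∷ y ∷ z ∷ rest) = Arc D z x × BackArcs D (y ∷ z ∷ rest)

-- a reverse square k-path (k = length of the list): distinct vertices,
-- forward arcs and back arcs as in the definition
IsReverseSquarePath : ∀ {n} → Digraph n → List (Fin n) → Set
IsReverseSquarePath D P = Unique P × ForwardArcs D P × BackArcs D P

FirstEndArc : ∀ {n} → List (Fin n) → Fin n → Fin n → Set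
FirstEndArc P a b = ∃ λ rest → P ≡ a ∷ b ∷ rest

LastEndArc : ∀ {n} → List (Fin n) → Fin n → Fin n → Set
LastEndArc P c d = ∃ λ init → P ≡ init ++ (c ∷ d ∷ [])

{-# OPTIONS --safe #-}
module Submission where

-- Write γ = k/Q with k ≥ 1, so every in- and out-neighbourhood has at least (2/3 + 1/Q)n
-- vertices, and any three of them share at least 3n/Q vertices: enough to avoid a few
-- prescribed vertices and, once n ≥ Q² + 4Q, also the at most 2n/Q popular vertices below.
-- The path is a b w₁ r p z w₂ s c d, with 10 < 24 < 4/γ vertices.  For every p pick
-- w₁(p) ∈ N⁺(b) ∩ N⁻(a) ∩ N⁺(p) and r(p) ∈ N⁺(w₁(p)) ∩ N⁻(b) ∩ N⁻(p).  The sets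
-- G(p) = N⁺(p) ∩ N⁻(r(p)) have about (1/3 + 2/Q)n elements, so by averaging some z lies in
-- as many of them.  Next s ∈ N⁻(z) ∩ N⁻(c) ∩ N⁺(d) and w₂ ∈ N⁺(z) ∩ N⁻(s) ∩ N⁺(c) are chosen
-- unpopular, i.e. equal to w₁(p) or r(p) for fewer than Q values of p.  This is what lets
-- the last vertex p, with z ∈ G(p) and w₂ → p, be chosen with w₁(p) and r(p) avoiding s and w₂.

module Counting where

  open import Defs using (countᵇ; allV)
  open import Data.Bool using (Bool; true; false; _∧_; _∨_; not; T)
  open import Data.Fin using (Fin; zero; suc; _≟_)
  open import Data.List using (List; []; _∷_; length; tabulate; allFin)
  open import Data.List.Extrema.Nat using (argmax; f[xs]≤f[argmax])
  open import Data.List.Membership.DecPropositional using (_∈?_)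
  open import Data.List.Membership.Propositional.Properties using (∈-allFin)
  open import Data.List.Relation.Unary.All as All using (All)
  open import Data.List.Relation.Unary.All.Properties using (¬Any⇒All¬)
  open import Data.Nat using (ℕ; zero; suc; _+_; _*_; _≤_; _<_; z≤n; NonZero; _≤ᵇ_)
  open import Data.Nat.Properties hiding (_≟_)
  open import Data.Nat.Tactic.RingSolver using (solve-∀)
  open import Algebra.Properties.Semiring.Sum +-*-semiring
    using (sum-syntax; ∑-comm; ∑-distrib-+; sum-cong-≗; *-distribˡ-sum; *-distribʳ-sum)
  open import Data.Product using (∃; _×_; _,_)
  open import Function using (_∘_; flip)
  open import Relation.Binary.PropositionalEquality
  open import Relation.Nullary.Decidable using (does; no)

  𝟙 : Bool → ℕ
  𝟙 true  = 1
  𝟙 false = 0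

  ∑-mono-≤ : ∀ {n} {f g : Fin n → ℕ} → (∀ i → f i ≤ g i) → ∑[ i < n ] f i ≤ ∑[ i < n ] g i
  ∑-mono-≤ {zero}  f≤g = z≤n
  ∑-mono-≤ {suc n} f≤g = +-mono-≤ (f≤g zero) (∑-mono-≤ {n} (f≤g ∘ suc))

  ∑-const : ∀ {n} (c : ℕ) → ∑[ i < n ] c ≡ n * c
  ∑-const {zero}  c = refl
  ∑-const {suc n} c = cong (c +_) (∑-const {n} c)

  ∑≤n*max : ∀ {n} → .{{NonZero n}} → (f : Fin n → ℕ) → ∃ λ j → ∑[ i < n ] f i ≤ n * f j
  ∑≤n*max {suc n} f = j , ≤-trans (∑-mono-≤ {suc n} f≤fj) (≤-reflexive (∑-const {suc n} (f j)))
    where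
    j : Fin (suc n)
    j = argmax f zero (allFin (suc n))
    f≤fj : ∀ i → f i ≤ f j
    f≤fj i = All.lookup (f[xs]≤f[argmax] {f = f} zero (allFin (suc n))) (∈-allFin i)

  ∧≡true : ∀ {x y} → x ∧ y ≡ true → x ≡ true × y ≡ true
  ∧≡true {true} {true} _ = refl , refl

  ∧-not≡true : ∀ {x y} → x ∧ not y ≡ true → x ≡ true × y ≡ false
  ∧-not≡true {true} {false} _ = refl , refl

  ∨≡false : ∀ {x y} → x ∨ y ≡ false → x ≡ false × y ≡ false
  ∨≡false {false} {false} _ = refl , refl

  module _ {A : Set} where

    infixr 7 _∩_
    infixr 6 _∪_
    infixl 6 _─_

    _∩_ _∪_ _─_ : (A → Bool) → (A → Bool) → A → Bool
    (P ∩ R) x = P x ∧ R x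
    (P ∪ R) x = P x ∨ R x
    (P ─ R) x = P x ∧ not (R x)

    ∅ : A → Bool
    ∅ _ = false

  ⟦_⟧ : ∀ {n} → List (Fin n) → Fin n → Bool
  ⟦ ys ⟧ v = does (_∈?_ _≟_ v ys)

  ⟦⟧≡false : ∀ {n} {v : Fin n} ys → ⟦ ys ⟧ v ≡ false → All (v ≢_) ys
  ⟦⟧≡false {v = v} ys v∉ys with _∈?_ _≟_ v ys
  ... | no v∉ys = ¬Any⇒All¬ ys v∉ys

  ∣_∣ : ∀ {n} → (Fin n → Bool) → ℕ
  ∣_∣ {n} P = ∑[ v < n ] 𝟙 (P v)

  countᵇ-tabulate : ∀ {A : Set} {n} (P : A → Bool) (f : Fin n → A) →
                    countᵇ P (tabulate f) ≡ ∑[ i < n ] 𝟙 (P (f i))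
  countᵇ-tabulate {n = zero}  P f = refl
  countᵇ-tabulate {n = suc n} P f with P (f zero)
  ... | true  = cong suc (countᵇ-tabulate P (f ∘ suc))
  ... | false = countᵇ-tabulate P (f ∘ suc)

  countᵇ-allV : ∀ {n} (P : Fin n → Bool) → countᵇ P (allV n) ≡ ∣ P ∣
  countᵇ-allV P = countᵇ-tabulate P (λ v → v)

  ∣∅∣≡0 : ∀ n → ∣ ∅ {Fin n} ∣ ≡ 0
  ∣∅∣≡0 n = trans (∑-const {n} 0) (*-zeroʳ n)

  module _ {n : ℕ} where

    ∣P∣≤n : (P : Fin n → Bool) → ∣ P ∣ ≤ n
    ∣P∣≤n P = begin
      ∣ P ∣           ≤⟨ ∑-mono-≤ {n} (λ v → 𝟙≤1 (P v)) ⟩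
      ∑[ v < n ] 1   ≡⟨ ∑-const {n} 1 ⟩
      n * 1          ≡⟨ *-identityʳ n ⟩
      n              ∎
      where
      open ≤-Reasoning
      𝟙≤1 : ∀ x → 𝟙 x ≤ 1
      𝟙≤1 true  = ≤-refl
      𝟙≤1 false = z≤n

    ∣P∩R∣+∣P∪R∣≡∣P∣+∣R∣ : (P R : Fin n → Bool) → ∣ P ∩ R ∣ + ∣ P ∪ R ∣ ≡ ∣ P ∣ + ∣ R ∣
    ∣P∩R∣+∣P∪R∣≡∣P∣+∣R∣ P R = begin
      ∣ P ∩ R ∣ + ∣ P ∪ R ∣                         ≡⟨ ∑-distrib-+ (𝟙 ∘ (P ∩ R)) (𝟙 ∘ (P ∪ R)) ⟨
      ∑[ v < n ] (𝟙 ((P ∩ R) v) + 𝟙 ((P ∪ R) v))  ≡⟨ sum-cong-≗ (λ v → pointwise (P v) (R v)) ⟩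
      ∑[ v < n ] (𝟙 (P v) + 𝟙 (R v))              ≡⟨ ∑-distrib-+ (𝟙 ∘ P) (𝟙 ∘ R) ⟩
      ∣ P ∣ + ∣ R ∣                                 ∎
      where
      open ≡-Reasoning
      pointwise : ∀ x y → 𝟙 (x ∧ y) + 𝟙 (x ∨ y) ≡ 𝟙 x + 𝟙 y
      pointwise true  true  = refl
      pointwise true  false = refl
      pointwise false y     = refl

    ∣P∣+∣R∣≤∣P∩R∣+n : (P R : Fin n → Bool) → ∣ P ∣ + ∣ R ∣ ≤ ∣ P ∩ R ∣ + n
    ∣P∣+∣R∣≤∣P∩R∣+n P R = begin
      ∣ P ∣ + ∣ R ∣          ≡⟨ ∣P∩R∣+∣P∪R∣≡∣P∣+∣R∣ P R ⟨
      ∣ P ∩ R ∣ + ∣ P ∪ R ∣  ≤⟨ +-monoʳ-≤ (∣ P ∩ R ∣) (∣P∣≤n (P ∪ R)) ⟩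
      ∣ P ∩ R ∣ + n          ∎
      where open ≤-Reasoning

    ∣P∪R∣≤∣P∣+∣R∣ : (P R : Fin n → Bool) → ∣ P ∪ R ∣ ≤ ∣ P ∣ + ∣ R ∣
    ∣P∪R∣≤∣P∣+∣R∣ P R = begin
      ∣ P ∪ R ∣              ≤⟨ m≤n+m (∣ P ∪ R ∣) (∣ P ∩ R ∣) ⟩
      ∣ P ∩ R ∣ + ∣ P ∪ R ∣  ≡⟨ ∣P∩R∣+∣P∪R∣≡∣P∣+∣R∣ P R ⟩
      ∣ P ∣ + ∣ R ∣          ∎
      where open ≤-Reasoning

    ∣P∣≤∣P─R∣+∣R∣ : (P R : Fin n → Bool) → ∣ P ∣ ≤ ∣ P ─ R ∣ + ∣ R ∣
    ∣P∣≤∣P─R∣+∣R∣ P R = begin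
      ∣ P ∣                                  ≤⟨ ∑-mono-≤ {n} (λ v → pointwise (P v) (R v)) ⟩
      ∑[ v < n ] (𝟙 ((P ─ R) v) + 𝟙 (R v))  ≡⟨ ∑-distrib-+ (𝟙 ∘ (P ─ R)) (𝟙 ∘ R) ⟩
      ∣ P ─ R ∣ + ∣ R ∣                      ∎
      where
      open ≤-Reasoning
      pointwise : ∀ x y → 𝟙 x ≤ 𝟙 (x ∧ not y) + 𝟙 y
      pointwise true  true  = ≤-refl
      pointwise true  false = ≤-refl
      pointwise false y     = z≤n

  ∣⁅v⁆∣≡1 : ∀ {n} (v : Fin n) → ∣ (λ u → does (u ≟ v)) ∣ ≡ 1
  ∣⁅v⁆∣≡1 {suc n} zero    = cong suc (∣∅∣≡0 n)
  ∣⁅v⁆∣≡1 {suc n} (suc v) = ∣⁅v⁆∣≡1 v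

  ∣⟦ys⟧∣≤length : ∀ {n} (ys : List (Fin n)) → ∣ ⟦ ys ⟧ ∣ ≤ length ys
  ∣⟦ys⟧∣≤length {n} [] = ≤-reflexive (∣∅∣≡0 n)
  ∣⟦ys⟧∣≤length (y ∷ ys) = ≤-trans (∣P∪R∣≤∣P∣+∣R∣ (λ u → does (u ≟ y)) ⟦ ys ⟧)
                                   (+-mono-≤ (≤-reflexive (∣⁅v⁆∣≡1 y)) (∣⟦ys⟧∣≤length ys))

  witness : ∀ {n} (P : Fin n → Bool) → 0 < ∣ P ∣ → ∃ λ v → P v ≡ true
  witness {suc n} P ∣P∣>0 with P zero in P0
  ... | true  = zero , P0
  ... | false = let v , Pv = witness (P ∘ suc) ∣P∣>0 in suc v , Pv

  pick : ∀ {n} (P R : Fin n → Bool) (ys : List (Fin n)) → length ys + ∣ R ∣ < ∣ P ∣ →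
         ∃ λ v → P v ≡ true × R v ≡ false × All (v ≢_) ys
  pick {n} P R ys bound =
    let v , v∈S = witness S (+-cancelʳ-< (length ys + ∣ R ∣) 0 (∣ S ∣) (<-≤-trans bound ∣P∣≤∣S∣+ℓ))
        v∈P─R , v∉ys = ∧-not≡true v∈S
        v∈P , v∉R = ∧-not≡true v∈P─R
    in v , v∈P , v∉R , ⟦⟧≡false ys v∉ys
    where
    S : Fin n → Bool
    S = P ─ R ─ ⟦ ys ⟧
    ∣P∣≤∣S∣+ℓ : ∣ P ∣ ≤ ∣ S ∣ + (length ys + ∣ R ∣)
    ∣P∣≤∣S∣+ℓ = begin
      ∣ P ∣                              ≤⟨ ∣P∣≤∣P─R∣+∣R∣ P R ⟩
      ∣ P ─ R ∣ + ∣ R ∣                  ≤⟨ +-monoˡ-≤ (∣ R ∣) (∣P∣≤∣P─R∣+∣R∣ (P ─ R) ⟦ ys ⟧) ⟩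
      ∣ S ∣ + ∣ ⟦ ys ⟧ ∣ + ∣ R ∣          ≤⟨ +-monoˡ-≤ (∣ R ∣) (+-monoʳ-≤ (∣ S ∣) (∣⟦ys⟧∣≤length ys)) ⟩
      ∣ S ∣ + length ys + ∣ R ∣          ≡⟨ +-assoc (∣ S ∣) (length ys) (∣ R ∣) ⟩
      ∣ S ∣ + (length ys + ∣ R ∣)        ∎
      where open ≤-Reasoning

  heavy-columns : ∀ {m n} (R : Fin m → Fin n → Bool) {k} q → (∀ x → ∣ R x ∣ ≤ k) →
                  ∣ (λ y → q ≤ᵇ ∣ flip R y ∣) ∣ * q ≤ m * k
  heavy-columns {m} {n} R {k} q rows≤k = begin
    ∣ heavy ∣ * q                       ≡⟨ *-distribʳ-sum q (𝟙 ∘ heavy) ⟩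
    ∑[ y < n ] (𝟙 (heavy y) * q)        ≤⟨ ∑-mono-≤ {n} (λ y → pointwise (∣ flip R y ∣)) ⟩
    ∑[ y < n ] ∣ flip R y ∣             ≡⟨ ∑-comm (λ x y → 𝟙 (R x y)) ⟨
    ∑[ x < m ] ∣ R x ∣                  ≤⟨ ∑-mono-≤ {m} rows≤k ⟩
    ∑[ x < m ] k                        ≡⟨ ∑-const {m} k ⟩
    m * k                               ∎
    where
    open ≤-Reasoning
    heavy : Fin n → Bool
    heavy y = q ≤ᵇ ∣ flip R y ∣
    pointwise : ∀ c → 𝟙 (q ≤ᵇ c) * q ≤ c
    pointwise c with q ≤ᵇ c in q≤ᵇc
    ... | true  = ≤-trans (≤-reflexive (+-identityʳ q)) (≤ᵇ⇒≤ q c (subst T (sym q≤ᵇc) _))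
    ... | false = z≤n

  averaging : ∀ {n} .{{_ : NonZero n}} (R : Fin n → Fin n → Bool) {ℓ a c} →
              (∀ x → ℓ ≤ a * ∣ R x ∣ + c) → ∃ λ y → ℓ ≤ a * ∣ flip R y ∣ + c
  averaging {n} R {ℓ} {a} {c} rows≥ℓ with ∑≤n*max (λ y → ∣ flip R y ∣)
  ... | y , ∑≤n*col = y , *-cancelˡ-≤ n (begin
    n * ℓ                                  ≡⟨ ∑-const {n} ℓ ⟨
    ∑[ x < n ] ℓ                           ≤⟨ ∑-mono-≤ {n} rows≥ℓ ⟩
    ∑[ x < n ] (a * ∣ R x ∣ + c)           ≡⟨ ∑-distrib-+ (λ x → a * ∣ R x ∣) (λ _ → c) ⟩
    ∑[ x < n ] (a * ∣ R x ∣) + ∑[ x < n ] c ≡⟨ cong₂ _+_ (*-distribˡ-sum a (λ x → ∣ R x ∣)) (sym (∑-const {n} c)) ⟨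
    a * ∑[ x < n ] ∣ R x ∣ + n * c          ≡⟨ cong (λ t → a * t + n * c) (∑-comm (λ x y → 𝟙 (R x y))) ⟩
    a * ∑[ y < n ] ∣ flip R y ∣ + n * c     ≤⟨ +-monoˡ-≤ (n * c) (*-monoʳ-≤ a ∑≤n*col) ⟩
    a * (n * ∣ flip R y ∣) + n * c          ≡⟨ rearrange a n (∣ flip R y ∣) c ⟩
    n * (a * ∣ flip R y ∣ + c)              ∎)
    where
    open ≤-Reasoning
    rearrange : ∀ a n t c → a * (n * t) + n * c ≡ n * (a * t + c)
    rearrange = solve-∀

  ∣S₁∣+∣S₂∣+∣S₃∣≤∣S₁∩S₂∩S₃∣+2n : ∀ {n} (S₁ S₂ S₃ : Fin n → Bool) →
                                 ∣ S₁ ∣ + ∣ S₂ ∣ + ∣ S₃ ∣ ≤ ∣ S₁ ∩ S₂ ∩ S₃ ∣ + n + n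
  ∣S₁∣+∣S₂∣+∣S₃∣≤∣S₁∩S₂∩S₃∣+2n {n} S₁ S₂ S₃ = begin
    ∣ S₁ ∣ + ∣ S₂ ∣ + ∣ S₃ ∣        ≡⟨ +-assoc (∣ S₁ ∣) (∣ S₂ ∣) (∣ S₃ ∣) ⟩
    ∣ S₁ ∣ + (∣ S₂ ∣ + ∣ S₃ ∣)      ≤⟨ +-monoʳ-≤ (∣ S₁ ∣) (∣P∣+∣R∣≤∣P∩R∣+n S₂ S₃) ⟩
    ∣ S₁ ∣ + (∣ S₂ ∩ S₃ ∣ + n)      ≡⟨ +-assoc (∣ S₁ ∣) (∣ S₂ ∩ S₃ ∣) n ⟨
    ∣ S₁ ∣ + ∣ S₂ ∩ S₃ ∣ + n        ≤⟨ +-monoˡ-≤ n (∣P∣+∣R∣≤∣P∩R∣+n S₁ (S₂ ∩ S₃)) ⟩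
    ∣ S₁ ∩ S₂ ∩ S₃ ∣ + n + n        ∎
    where open ≤-Reasoning

module Construction where

  open import Defs
  open Counting
  open import Data.Bool using (Bool; true; false; T)
  open import Data.Fin using (Fin)
  open import Data.List using (List; []; _∷_; length)
  open import Data.List.Relation.Unary.All using (All; []; _∷_)
  open import Data.List.Relation.Unary.AllPairs using ([]; _∷_)
  open import Data.List.Relation.Unary.Unique.Propositional using (Unique)
  open import Data.Nat using (ℕ; suc; _+_; _*_; _≤_; _<_; z≤n; s≤s; NonZero; >-nonZero; >-nonZero⁻¹; _≤ᵇ_)
  open import Data.Nat.Properties
  open import Data.Nat.Tactic.RingSolver using (solve-∀)
  open import Data.Product using (∃; _×_; _,_; proj₁; proj₂)
  open import Data.Unit using (tt)
  open import Function using (_∘_; flip)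
  open import Relation.Binary.PropositionalEquality

  -- ∣ S ∣ ≥ (2/3 + 1/Q) n, cleared of denominators.
  Dense : ∀ {n} → ℕ → (Fin n → Bool) → Set
  Dense {n} Q S = (2 * Q + 3) * n ≤ 3 * Q * ∣ S ∣

  dense-∩³ : ∀ {n Q} (S₁ S₂ S₃ : Fin n → Bool) → Dense Q S₁ → Dense Q S₂ → Dense Q S₃ →
             3 * n ≤ Q * ∣ S₁ ∩ S₂ ∩ S₃ ∣
  dense-∩³ {n} {Q} S₁ S₂ S₃ d₁ d₂ d₃ = *-cancelˡ-≤ 3 (+-cancelʳ-≤ (6 * Q * n) _ _ (begin
    3 * (3 * n) + 6 * Q * n                            ≡⟨ lhs Q n ⟩
    (2 * Q + 3) * n + (2 * Q + 3) * n + (2 * Q + 3) * n ≤⟨ +-mono-≤ (+-mono-≤ d₁ d₂) d₃ ⟩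
    3 * Q * ∣ S₁ ∣ + 3 * Q * ∣ S₂ ∣ + 3 * Q * ∣ S₃ ∣     ≡⟨ mid Q (∣ S₁ ∣) (∣ S₂ ∣) (∣ S₃ ∣) ⟩
    3 * Q * (∣ S₁ ∣ + ∣ S₂ ∣ + ∣ S₃ ∣)                  ≤⟨ *-monoʳ-≤ (3 * Q) sizes ⟩
    3 * Q * (∣ S₁ ∩ S₂ ∩ S₃ ∣ + n + n)                  ≡⟨ rhs Q (∣ S₁ ∩ S₂ ∩ S₃ ∣) n ⟩
    3 * (Q * ∣ S₁ ∩ S₂ ∩ S₃ ∣) + 6 * Q * n              ∎))
    where
    open ≤-Reasoning
    sizes : ∣ S₁ ∣ + ∣ S₂ ∣ + ∣ S₃ ∣ ≤ ∣ S₁ ∩ S₂ ∩ S₃ ∣ + n + n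
    sizes = ∣S₁∣+∣S₂∣+∣S₃∣≤∣S₁∩S₂∩S₃∣+2n S₁ S₂ S₃
    lhs : ∀ Q n → 3 * (3 * n) + 6 * Q * n ≡ (2 * Q + 3) * n + (2 * Q + 3) * n + (2 * Q + 3) * n
    lhs = solve-∀
    mid : ∀ Q x y w → 3 * Q * x + 3 * Q * y + 3 * Q * w ≡ 3 * Q * (x + y + w)
    mid = solve-∀
    rhs : ∀ Q t n → 3 * Q * (t + n + n) ≡ 3 * (Q * t) + 6 * Q * n
    rhs = solve-∀

  pick-dense : ∀ {n Q} .{{_ : NonZero Q}} → 4 * Q ≤ n →
               (S₁ S₂ S₃ R : Fin n → Bool) (ys : List (Fin n)) →
               Dense Q S₁ → Dense Q S₂ → Dense Q S₃ → ∣ R ∣ * Q ≤ n * 2 → length ys ≤ 3 →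
               ∃ λ v → S₁ v ≡ true × S₂ v ≡ true × S₃ v ≡ true × R v ≡ false × All (v ≢_) ys
  pick-dense {n} {Q} 4Q≤n S₁ S₂ S₃ R ys d₁ d₂ d₃ R-small ys≤3 =
    let v , v∈S , v∉R , v∉ys = pick (S₁ ∩ S₂ ∩ S₃) R ys (<-≤-trans ys+R<R+4 R+4≤S)
        v∈S₁ , v∈S₂∩S₃ = ∧≡true v∈S
        v∈S₂ , v∈S₃ = ∧≡true v∈S₂∩S₃
    in v , v∈S₁ , v∈S₂ , v∈S₃ , v∉R , v∉ys
    where
    open ≤-Reasoning
    ys+R<R+4 : length ys + ∣ R ∣ < ∣ R ∣ + 4
    ys+R<R+4 = begin-strict
      length ys + ∣ R ∣  ≤⟨ +-monoˡ-≤ (∣ R ∣) ys≤3 ⟩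
      3 + ∣ R ∣          <⟨ n<1+n (3 + ∣ R ∣) ⟩
      4 + ∣ R ∣          ≡⟨ +-comm 4 (∣ R ∣) ⟩
      ∣ R ∣ + 4          ∎
    R+4≤S : ∣ R ∣ + 4 ≤ ∣ S₁ ∩ S₂ ∩ S₃ ∣
    R+4≤S = *-cancelˡ-≤ Q (begin
      Q * (∣ R ∣ + 4)            ≡⟨ distrib Q (∣ R ∣) ⟩
      ∣ R ∣ * Q + 4 * Q          ≤⟨ +-mono-≤ R-small 4Q≤n ⟩
      n * 2 + n                  ≡⟨ triple n ⟩
      3 * n                      ≤⟨ dense-∩³ {Q = Q} S₁ S₂ S₃ d₁ d₂ d₃ ⟩
      Q * ∣ S₁ ∩ S₂ ∩ S₃ ∣       ∎)
      where
      distrib : ∀ Q r → Q * (r + 4) ≡ r * Q + 4 * Q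
      distrib = solve-∀
      triple : ∀ n → n * 2 + n ≡ 3 * n
      triple = solve-∀

  n₀ : ℕ → ℕ
  n₀ Q = Q * Q + 4 * Q

  N⁺ N⁻ : ∀ {n} → Digraph n → Fin n → Fin n → Bool
  N⁺ D u v = adj D u v
  N⁻ D u v = adj D v u

  arc⇒≢ : ∀ {n} (D : Digraph n) {u v} → Arc D u v → u ≢ v
  arc⇒≢ D {u} uv refl with trans (sym uv) (loopless D u)
  ... | ()

  module ReverseSquarePath {n} (D : Digraph n) (Q : ℕ) .{{_ : NonZero Q}} (n-large : n₀ Q ≤ n)
    (δ⁰-large : ∀ v → (2 * Q + 3) * n ≤ 3 * Q * outdeg D v × (2 * Q + 3) * n ≤ 3 * Q * indeg D v)
    {a b c d : Fin n} (ab : Arc D a b) (cd : Arc D c d)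
    (a≢c : a ≢ c) (a≢d : a ≢ d) (b≢c : b ≢ c) (b≢d : b ≢ d) where

    private
      4Q≤n : 4 * Q ≤ n
      4Q≤n = ≤-trans (m≤n+m (4 * Q) (Q * Q)) n-large

      instance
        n≢0 : NonZero n
        n≢0 = >-nonZero (<-≤-trans (>-nonZero⁻¹ Q) (≤-trans (m≤n*m Q 4) 4Q≤n))

      out-dense : ∀ v → Dense Q (N⁺ D v)
      out-dense v = subst (λ t → (2 * Q + 3) * n ≤ 3 * Q * t) (countᵇ-allV (N⁺ D v)) (proj₁ (δ⁰-large v))

      in-dense : ∀ v → Dense Q (N⁻ D v)
      in-dense v = subst (λ t → (2 * Q + 3) * n ≤ 3 * Q * t) (countᵇ-allV (N⁻ D v)) (proj₂ (δ⁰-large v))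

      ∣∅∣-small : ∣ ∅ {Fin n} ∣ * Q ≤ n * 2
      ∣∅∣-small = subst (λ k → k * Q ≤ n * 2) (sym (∣∅∣≡0 n)) z≤n

    -- The choices are abstract: unfolding the counting proofs behind the chosen vertices
    -- slows type checking down severalfold.
    abstract
      w₁-choice : ∀ p → ∃ λ w → Arc D b w × Arc D w a × Arc D p w × All (w ≢_) (c ∷ d ∷ [])
      w₁-choice p =
        let w , b→w , w→a , p→w , _ , w∉cd =
              pick-dense 4Q≤n (N⁺ D b) (N⁻ D a) (N⁺ D p) ∅ (c ∷ d ∷ [])
                         (out-dense b) (in-dense a) (out-dense p) ∣∅∣-small (s≤s (s≤s z≤n))
        in w , b→w , w→a , p→w , w∉cd

    w₁ : Fin n → Fin n
    w₁ = proj₁ ∘ w₁-choice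

    abstract
      r-choice : ∀ p → ∃ λ r → Arc D (w₁ p) r × Arc D r b × Arc D r p × All (r ≢_) (a ∷ c ∷ d ∷ [])
      r-choice p =
        let r , w₁→r , r→b , r→p , _ , r∉acd =
              pick-dense 4Q≤n (N⁺ D (w₁ p)) (N⁻ D b) (N⁻ D p) ∅ (a ∷ c ∷ d ∷ [])
                         (out-dense (w₁ p)) (in-dense b) (in-dense p) ∣∅∣-small ≤-refl
        in r , w₁→r , r→b , r→p , r∉acd

    r : Fin n → Fin n
    r = proj₁ ∘ r-choice

    uses : Fin n → Fin n → Bool
    uses p = ⟦ w₁ p ∷ r p ∷ [] ⟧

    popular : Fin n → Bool
    popular v = Q ≤ᵇ ∣ flip uses v ∣

    few-popular : ∣ popular ∣ * Q ≤ n * 2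
    few-popular = heavy-columns uses Q (λ p → ∣⟦ys⟧∣≤length (w₁ p ∷ r p ∷ []))

    unpopular : ∀ {v} → popular v ≡ false → ∣ flip uses v ∣ < Q
    unpopular {v} not-popular = ≰⇒> λ Q≤uses → subst T not-popular (≤⇒≤ᵇ Q≤uses)

    G : Fin n → Fin n → Bool
    G p = N⁺ D p ∩ N⁻ D (r p) ─ ⟦ w₁ p ∷ a ∷ b ∷ c ∷ d ∷ [] ⟧

    G-large : ∀ p → (Q + 6) * n ≤ 3 * Q * ∣ G p ∣ + 15 * Q
    G-large p = +-cancelʳ-≤ (3 * Q * n) _ _ (begin
      (Q + 6) * n + 3 * Q * n                      ≡⟨ split Q n ⟩
      (2 * Q + 3) * n + (2 * Q + 3) * n            ≤⟨ +-mono-≤ (out-dense p) (in-dense (r p)) ⟩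
      3 * Q * ∣ N⁺ D p ∣ + 3 * Q * ∣ N⁻ D (r p) ∣  ≡⟨ *-distribˡ-+ (3 * Q) (∣ N⁺ D p ∣) (∣ N⁻ D (r p) ∣) ⟨
      3 * Q * (∣ N⁺ D p ∣ + ∣ N⁻ D (r p) ∣)        ≤⟨ *-monoʳ-≤ (3 * Q) sizes ⟩
      3 * Q * (∣ G p ∣ + 5 + n)                    ≡⟨ expand Q (∣ G p ∣) n ⟩
      3 * Q * ∣ G p ∣ + 15 * Q + 3 * Q * n         ∎)
      where
      open ≤-Reasoning
      excluded : List (Fin n)
      excluded = w₁ p ∷ a ∷ b ∷ c ∷ d ∷ []
      sizes : ∣ N⁺ D p ∣ + ∣ N⁻ D (r p) ∣ ≤ ∣ G p ∣ + 5 + n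
      sizes = ≤-trans (∣P∣+∣R∣≤∣P∩R∣+n (N⁺ D p) (N⁻ D (r p)))
                (+-monoˡ-≤ n (≤-trans (∣P∣≤∣P─R∣+∣R∣ (N⁺ D p ∩ N⁻ D (r p)) ⟦ excluded ⟧)
                                      (+-monoʳ-≤ (∣ G p ∣) (∣⟦ys⟧∣≤length excluded))))
      split : ∀ Q n → (Q + 6) * n + 3 * Q * n ≡ (2 * Q + 3) * n + (2 * Q + 3) * n
      split = solve-∀
      expand : ∀ Q g n → 3 * Q * (g + 5 + n) ≡ 3 * Q * g + 15 * Q + 3 * Q * n
      expand = solve-∀

    abstract
      z-choice : ∃ λ z → (Q + 6) * n ≤ 3 * Q * ∣ flip G z ∣ + 15 * Q
      z-choice = averaging G {(Q + 6) * n} {3 * Q} {15 * Q} G-large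

    z : Fin n
    z = proj₁ z-choice

    abstract
      s-choice : ∃ λ s → ∣ flip uses s ∣ < Q × Arc D s z × Arc D s c × Arc D d s × All (s ≢_) (a ∷ b ∷ [])
      s-choice =
        let s , s→z , s→c , d→s , s-unpopular , s∉ab =
              pick-dense 4Q≤n (N⁻ D z) (N⁻ D c) (N⁺ D d) popular (a ∷ b ∷ [])
                         (in-dense z) (in-dense c) (out-dense d) few-popular (s≤s (s≤s z≤n))
        in s , unpopular {s} s-unpopular , s→z , s→c , d→s , s∉ab

    s : Fin n
    s = proj₁ s-choice

    abstract
      w₂-choice : ∃ λ w → ∣ flip uses w ∣ < Q × Arc D z w × Arc D w s × Arc D c w × All (w ≢_) (a ∷ b ∷ d ∷ [])
      w₂-choice =
        let w , z→w , w→s , c→w , w-unpopular , w∉abd =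
              pick-dense 4Q≤n (N⁺ D z) (N⁻ D s) (N⁺ D c) popular (a ∷ b ∷ d ∷ [])
                         (out-dense z) (in-dense s) (out-dense c) few-popular ≤-refl
        in w , unpopular {w} w-unpopular , z→w , w→s , c→w , w∉abd

    w₂ : Fin n
    w₂ = proj₁ w₂-choice

    many-p-candidates : 2 * Q + 4 ≤ ∣ flip G z ∩ N⁺ D w₂ ∣
    many-p-candidates = +-cancelˡ-≤ n _ _ (begin
      n + (2 * Q + 4)                 ≤⟨ sizes ⟩
      ∣ flip G z ∣ + ∣ N⁺ D w₂ ∣      ≤⟨ ∣P∣+∣R∣≤∣P∩R∣+n (flip G z) (N⁺ D w₂) ⟩
      ∣ flip G z ∩ N⁺ D w₂ ∣ + n      ≡⟨ +-comm (∣ flip G z ∩ N⁺ D w₂ ∣) n ⟩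
      n + ∣ flip G z ∩ N⁺ D w₂ ∣      ∎)
      where
      open ≤-Reasoning
      sizes : n + (2 * Q + 4) ≤ ∣ flip G z ∣ + ∣ N⁺ D w₂ ∣
      sizes = *-cancelˡ-≤ (3 * Q) {{m*n≢0 3 Q}} (+-cancelʳ-≤ (15 * Q) _ _ (begin
        3 * Q * (n + (2 * Q + 4)) + 15 * Q                   ≡⟨ expand Q n ⟩
        3 * Q * n + 3 * (2 * Q * Q + 9 * Q)                  ≤⟨ +-monoʳ-≤ (3 * Q * n) (*-monoʳ-≤ 3 quadratic≤3n) ⟩
        3 * Q * n + 3 * (3 * n)                              ≡⟨ regroup Q n ⟩
        (Q + 6) * n + (2 * Q + 3) * n                        ≤⟨ +-mono-≤ (proj₂ z-choice) (out-dense w₂) ⟩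
        3 * Q * ∣ flip G z ∣ + 15 * Q + 3 * Q * ∣ N⁺ D w₂ ∣  ≡⟨ collect Q (∣ flip G z ∣) (∣ N⁺ D w₂ ∣) ⟩
        3 * Q * (∣ flip G z ∣ + ∣ N⁺ D w₂ ∣) + 15 * Q        ∎))
        where
        quadratic≤3n : 2 * Q * Q + 9 * Q ≤ 3 * n
        quadratic≤3n = begin
          2 * Q * Q + 9 * Q     ≤⟨ +-mono-≤ (*-monoˡ-≤ Q (*-monoˡ-≤ Q (m≤m+n 2 1))) (*-monoˡ-≤ Q (m≤m+n 9 3)) ⟩
          3 * Q * Q + 12 * Q    ≡⟨ factor Q ⟩
          3 * (Q * Q + 4 * Q)   ≤⟨ *-monoʳ-≤ 3 n-large ⟩
          3 * n                 ∎
          where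
          factor : ∀ Q → 3 * Q * Q + 12 * Q ≡ 3 * (Q * Q + 4 * Q)
          factor = solve-∀
        expand : ∀ Q n → 3 * Q * (n + (2 * Q + 4)) + 15 * Q ≡ 3 * Q * n + 3 * (2 * Q * Q + 9 * Q)
        expand = solve-∀
        regroup : ∀ Q n → 3 * Q * n + 3 * (3 * n) ≡ (Q + 6) * n + (2 * Q + 3) * n
        regroup = solve-∀
        collect : ∀ Q g o → 3 * Q * g + 15 * Q + 3 * Q * o ≡ 3 * Q * (g + o) + 15 * Q
        collect = solve-∀

    few-p-excluded : 5 + ∣ flip uses s ∪ flip uses w₂ ∣ < ∣ flip G z ∩ N⁺ D w₂ ∣
    few-p-excluded = begin-strict
      5 + ∣ flip uses s ∪ flip uses w₂ ∣        ≤⟨ +-monoʳ-≤ 5 (∣P∪R∣≤∣P∣+∣R∣ (flip uses s) (flip uses w₂)) ⟩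
      5 + (∣ flip uses s ∣ + ∣ flip uses w₂ ∣)  <⟨ both-below-Q (proj₁ (proj₂ s-choice)) (proj₁ (proj₂ w₂-choice)) ⟩
      2 * Q + 4                                ≤⟨ many-p-candidates ⟩
      ∣ flip G z ∩ N⁺ D w₂ ∣                   ∎
      where
      open ≤-Reasoning
      both-below-Q : ∀ {x y} → x < Q → y < Q → 5 + (x + y) < 2 * Q + 4
      both-below-Q {x} {y} x<Q y<Q = begin-strict
        5 + (x + y)          <⟨ n<1+n _ ⟩
        6 + (x + y)          ≡⟨ cong (5 +_) (+-suc x y) ⟨
        4 + (suc x + suc y)  ≤⟨ +-monoʳ-≤ 4 (+-mono-≤ x<Q y<Q) ⟩
        4 + (Q + Q)          ≡⟨ double Q ⟩
        2 * Q + 4            ∎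
        where
        double : ∀ Q → 4 + (Q + Q) ≡ 2 * Q + 4
        double = solve-∀

    abstract
      p-choice : ∃ λ p → Arc D p z × Arc D z (r p) × Arc D w₂ p ×
                         All (z ≢_) (w₁ p ∷ a ∷ b ∷ c ∷ d ∷ []) ×
                         All (s ≢_) (w₁ p ∷ r p ∷ []) × All (w₂ ≢_) (w₁ p ∷ r p ∷ []) ×
                         All (p ≢_) (a ∷ b ∷ c ∷ d ∷ s ∷ [])
      p-choice =
        let p , p∈P , p∉R , p∉ys = pick (flip G z ∩ N⁺ D w₂) (flip uses s ∪ flip uses w₂) (a ∷ b ∷ c ∷ d ∷ s ∷ [])
                                        few-p-excluded
            z∈Gp , w₂→p = ∧≡true p∈P
            z∈N⁺p∩N⁻r , z∉excluded = ∧-not≡true z∈Gp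
            p→z , z→r = ∧≡true z∈N⁺p∩N⁻r
            s∉uses , w₂∉uses = ∨≡false p∉R
        in p , p→z , z→r , w₂→p , ⟦⟧≡false _ z∉excluded , ⟦⟧≡false _ s∉uses , ⟦⟧≡false _ w₂∉uses , p∉ys

    p : Fin n
    p = proj₁ p-choice

    reverse-square-path : ∃ λ P → IsReverseSquarePath D P × length P ≡ 10 ×
                                  FirstEndArc P a b × LastEndArc P c d
    reverse-square-path
      with proj₂ (w₁-choice p) | proj₂ (r-choice p) | proj₂ s-choice | proj₂ w₂-choice | proj₂ p-choice
    ... | b→w₁ , w₁→a , p→w₁ , w₁≢c ∷ w₁≢d ∷ []
        | w₁→r , r→b , r→p , r≢a ∷ r≢c ∷ r≢d ∷ []
        | _ , s→z , s→c , d→s , s≢a ∷ s≢b ∷ []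
        | _ , z→w₂ , w₂→s , c→w₂ , w₂≢a ∷ w₂≢b ∷ w₂≢d ∷ []
        | p→z , z→r , w₂→p , z≢w₁ ∷ z≢a ∷ z≢b ∷ z≢c ∷ z≢d ∷ [] , s≢w₁ ∷ s≢r ∷ [] , w₂≢w₁ ∷ w₂≢r ∷ []
        , p≢a ∷ p≢b ∷ p≢c ∷ p≢d ∷ p≢s ∷ [] =
      path , (distinct , forward , backward) , refl ,
      (_ , refl) , (a ∷ b ∷ w₁ p ∷ r p ∷ p ∷ z ∷ w₂ ∷ s ∷ [] , refl)
      where
      path : List (Fin n)
      path = a ∷ b ∷ w₁ p ∷ r p ∷ p ∷ z ∷ w₂ ∷ s ∷ c ∷ d ∷ []
      forward : ForwardArcs D path
      forward = ab , b→w₁ , w₁→r , r→p , p→z , z→w₂ , w₂→s , s→c , cd , tt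
      backward : BackArcs D path
      backward = w₁→a , r→b , p→w₁ , z→r , w₂→p , s→z , c→w₂ , d→s , tt
      ≠ : ∀ {u v} → Arc D u v → u ≢ v
      ≠ = arc⇒≢ D
      distinct : Unique path
      distinct = (≠ ab ∷ ≢-sym (≠ w₁→a) ∷ ≢-sym r≢a ∷ ≢-sym p≢a ∷ ≢-sym z≢a ∷ ≢-sym w₂≢a ∷ ≢-sym s≢a ∷ a≢c ∷ a≢d ∷ [])
               ∷ (≠ b→w₁ ∷ ≢-sym (≠ r→b) ∷ ≢-sym p≢b ∷ ≢-sym z≢b ∷ ≢-sym w₂≢b ∷ ≢-sym s≢b ∷ b≢c ∷ b≢d ∷ [])
               ∷ (≠ w₁→r ∷ ≢-sym (≠ p→w₁) ∷ ≢-sym z≢w₁ ∷ ≢-sym w₂≢w₁ ∷ ≢-sym s≢w₁ ∷ w₁≢c ∷ w₁≢d ∷ [])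
               ∷ (≠ r→p ∷ ≢-sym (≠ z→r) ∷ ≢-sym w₂≢r ∷ ≢-sym s≢r ∷ r≢c ∷ r≢d ∷ [])
               ∷ (≠ p→z ∷ ≢-sym (≠ w₂→p) ∷ p≢s ∷ p≢c ∷ p≢d ∷ [])
               ∷ (≠ z→w₂ ∷ ≢-sym (≠ s→z) ∷ z≢c ∷ z≢d ∷ [])
               ∷ (≠ w₂→s ∷ ≢-sym (≠ c→w₂) ∷ w₂≢d ∷ [])
               ∷ (≠ s→c ∷ ≢-sym (≠ d→s) ∷ [])
               ∷ (≠ cd ∷ [])
               ∷ []
               ∷ []

open import Data.Nat using (ℕ; suc)
open import Data.Nat.Coprimality using (Coprime)

-- A positive γ is (k + 1)/(m + 1), and Q = m + 1 satisfies γ ≥ 1/Q.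
module RationalBounds (k m : ℕ) .(coprime : Coprime (suc k) (suc m)) where

  open import Defs using (Digraph; outdeg; indeg; δ⁰≥; ℕ→ℚ)
  open import Data.Nat using (_+_; _*_; _≤_; _<_)
  open import Data.Nat.Coprimality using (1-coprimeTo) renaming (sym to coprime-sym)
  open import Data.Nat.Properties
    using (*-monoˡ-≤; *-monoʳ-≤; +-monoʳ-≤; m≤n*m; m≤m+n; *-identityʳ; module ≤-Reasoning)
  open import Data.Nat.Tactic.RingSolver using (solve-∀)
  open import Data.Integer as ℤ using (+_; +[1+_])
  open import Data.Integer.Properties using (pos-*; pos-+; drop‿+≤+; drop‿+<+)
  open import Data.Product using (_×_; _,_; proj₁; proj₂)
  open import Data.Rational as ℚ using (ℚ; mkℚ; toℚᵘ)
  open import Data.Rational.Properties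
    using (toℚᵘ-mono-≤; toℚᵘ-mono-<; toℚᵘ-cancel-≤; toℚᵘ-homo-*; toℚᵘ-homo-+; normalize-coprime)
  open import Data.Rational.Unnormalised as ℚᵘ using (mkℚᵘ; *≤*)
  import Data.Rational.Unnormalised.Properties as ℚᵘ
  open import Relation.Binary.PropositionalEquality

  private
    γ : ℚ
    γ = mkℚ +[1+ k ] m coprime

    Q : ℕ
    Q = suc m

    toℚᵘ-ℕ→ℚ : ∀ x → toℚᵘ (ℕ→ℚ x) ≡ mkℚᵘ (+ x) 0
    toℚᵘ-ℕ→ℚ x = cong toℚᵘ (normalize-coprime (coprime-sym (1-coprimeTo x)))

    cross-multiplied : ∀ n deg → ((+ 2) ℚ./ 3 ℚ.+ γ) ℚ.* ℕ→ℚ n ℚ.≤ ℕ→ℚ deg →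
                       (2 * Q + suc k * 3) * n * 1 ≤ deg * (3 * Q * 1)
    cross-multiplied n deg h = drop‿+≤+ (subst₂ ℤ._≤_ numerator (sym (pos-* deg (3 * Q * 1))) (ℚᵘ.drop-*≤* hᵘ))
      where
      open ≡-Reasoning
      homomorphic : toℚᵘ (((+ 2) ℚ./ 3 ℚ.+ γ) ℚ.* ℕ→ℚ n) ℚᵘ.≃ (mkℚᵘ (+ 2) 2 ℚᵘ.+ mkℚᵘ +[1+ k ] m) ℚᵘ.* mkℚᵘ (+ n) 0
      homomorphic = ℚᵘ.≃-trans (toℚᵘ-homo-* ((+ 2) ℚ./ 3 ℚ.+ γ) (ℕ→ℚ n))
                      (ℚᵘ.*-cong (toℚᵘ-homo-+ ((+ 2) ℚ./ 3) γ) (ℚᵘ.≃-reflexive (toℚᵘ-ℕ→ℚ n)))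
      hᵘ : (mkℚᵘ (+ 2) 2 ℚᵘ.+ mkℚᵘ +[1+ k ] m) ℚᵘ.* mkℚᵘ (+ n) 0 ℚᵘ.≤ mkℚᵘ (+ deg) 0
      hᵘ = ℚᵘ.≤-respˡ-≃ homomorphic (subst (_ ℚᵘ.≤_) (toℚᵘ-ℕ→ℚ deg) (toℚᵘ-mono-≤ h))
      -- ℚᵘ arithmetic yields ℤ terms that equal +_ of the ℕ terms only up to pos-* and pos-+.
      numerator : (+ 2 ℤ.* + Q ℤ.+ + suc k ℤ.* + 3) ℤ.* + n ℤ.* + 1 ≡ + ((2 * Q + suc k * 3) * n * 1)
      numerator = begin
        (+ 2 ℤ.* + Q ℤ.+ + suc k ℤ.* + 3) ℤ.* + n ℤ.* + 1 ≡⟨ cong (λ t → t ℤ.* + n ℤ.* + 1) coefficient ⟨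
        + (2 * Q + suc k * 3) ℤ.* + n ℤ.* + 1              ≡⟨ cong (ℤ._* + 1) (pos-* (2 * Q + suc k * 3) n) ⟨
        + ((2 * Q + suc k * 3) * n) ℤ.* + 1                ≡⟨ pos-* ((2 * Q + suc k * 3) * n) 1 ⟨
        + ((2 * Q + suc k * 3) * n * 1)                    ∎
        where
        coefficient : + (2 * Q + suc k * 3) ≡ + 2 ℤ.* + Q ℤ.+ + suc k ℤ.* + 3
        coefficient = trans (pos-+ (2 * Q) (suc k * 3)) (cong₂ ℤ._+_ (pos-* 2 Q) (pos-* (suc k) 3))

    degree-bound : ∀ n deg → ((+ 2) ℚ./ 3 ℚ.+ γ) ℚ.* ℕ→ℚ n ℚ.≤ ℕ→ℚ deg → (2 * Q + 3) * n ≤ 3 * Q * deg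
    degree-bound n deg h = begin
      (2 * Q + 3) * n              ≤⟨ *-monoˡ-≤ n (+-monoʳ-≤ (2 * Q) (m≤n*m 3 (suc k))) ⟩
      (2 * Q + suc k * 3) * n      ≡⟨ *-identityʳ _ ⟨
      (2 * Q + suc k * 3) * n * 1  ≤⟨ cross-multiplied n deg h ⟩
      deg * (3 * Q * 1)            ≡⟨ reorder deg Q ⟩
      3 * Q * deg                  ∎
      where
      open ≤-Reasoning
      reorder : ∀ deg Q → deg * (3 * Q * 1) ≡ 3 * Q * deg
      reorder = solve-∀

  δ⁰≥⇒degree-bounds : ∀ {n} (D : Digraph n) → δ⁰≥ D (((+ 2) ℚ./ 3 ℚ.+ γ) ℚ.* ℕ→ℚ n) →
                      ∀ v → (2 * Q + 3) * n ≤ 3 * Q * outdeg D v × (2 * Q + 3) * n ≤ 3 * Q * indeg D v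
  δ⁰≥⇒degree-bounds {n} D δ⁰ v = degree-bound n _ (proj₁ (δ⁰ v)) , degree-bound n _ (proj₂ (δ⁰ v))

  ten≤4/γ : γ ℚ.< (+ 1) ℚ./ 6 → ℕ→ℚ 10 ℚ.≤ (+ 4) ℚ./ 1 ℚ.÷ γ
  ten≤4/γ γ<1/6 = toℚᵘ-cancel-≤ (ℚᵘ.≤-respʳ-≃ (ℚᵘ.≃-sym (toℚᵘ-homo-* ((+ 4) ℚ./ 1) (ℚ.1/ γ)))
                    (*≤* (subst₂ ℤ._≤_ (pos-* 10 (1 * suc k)) (pos-* (4 * Q) 1) (ℤ.+≤+ 10K≤4Q))))
    where
    open ≤-Reasoning
    6K<Q : suc k * 6 < 1 * Q
    6K<Q = drop‿+<+ (subst₂ ℤ._<_ (sym (pos-* (suc k) 6)) (sym (pos-* 1 Q)) (ℚᵘ.drop-*<* (toℚᵘ-mono-< γ<1/6)))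
    10K≤4Q : 10 * (1 * suc k) ≤ 4 * Q * 1
    10K≤4Q = begin
      10 * (1 * suc k)                      ≤⟨ m≤m+n _ (14 * suc k + 4) ⟩
      10 * (1 * suc k) + (14 * suc k + 4)   ≡⟨ expand (suc k) ⟩
      4 * suc (suc k * 6)                   ≤⟨ *-monoʳ-≤ 4 6K<Q ⟩
      4 * (1 * Q)                           ≡⟨ reorder Q ⟩
      4 * Q * 1                             ∎
      where
      expand : ∀ K → 10 * (1 * K) + (14 * K + 4) ≡ 4 * suc (K * 6)
      expand = solve-∀
      reorder : ∀ Q → 4 * (1 * Q) ≡ 4 * Q * 1
      reorder = solve-∀

open import Defs
open import Data.Nat using (ℕ; _≥_)
open import Data.Fin using (Fin)
open import Data.List using (List; length)
open import Data.Product using (Σ; ∃; _×_)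
open import Relation.Binary.PropositionalEquality using (_≢_)
open import Data.Rational using (ℚ; 0ℚ; 1ℚ; _<_; _≤_; _+_; _*_; _÷_; _/_; >-nonZero)
open import Data.Integer using (+_)

open import Data.Integer using (+[1+_]; -[1+_]; +<+)
open import Data.Product using (_,_)
open import Data.Rational using (mkℚ; *<*)
open import Data.Rational.Properties using (positive⁻¹; ≤-refl)
open import Relation.Binary.PropositionalEquality using (subst; sym)
open Construction using (n₀; module ReverseSquarePath)

mainTheorem2 :
    Σ ℚ λ γ₀ → (0ℚ < γ₀) × (γ₀ ≤ (+ 1) / 6) ×
      (∀ (γ : ℚ) (γ>0 : 0ℚ < γ) → γ < γ₀ →
        ∃ λ (n₀ : ℕ) → ∀ (n : ℕ) → n ≥ n₀ → (D : Digraph n) →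
          δ⁰≥ D (((+ 2) / 3 + γ) * ℕ→ℚ n) →
          ∀ (a b c d : Fin n) → Arc D a b → Arc D c d →
          a ≢ c → a ≢ d → b ≢ c → b ≢ d →
          Σ (List (Fin n)) λ P →
            IsReverseSquarePath D P ×
            (ℕ→ℚ (length P) ≤ (((+ 4) / 1) ÷ γ) {{>-nonZero γ>0}}) ×
            FirstEndArc P a b × LastEndArc P c d)
mainTheorem2 = (+ 1) / 6 , positive⁻¹ ((+ 1) / 6) , ≤-refl , λ where
  (mkℚ +[1+ k ] m coprime) _ γ<1/6 → n₀ (suc m) , λ n n≥n₀ D δ⁰ a b c d ab cd a≢c a≢d b≢c b≢d →
    let open RationalBounds k m coprime
        open ReverseSquarePath D (suc m) n≥n₀ (δ⁰≥⇒degree-bounds D δ⁰) ab cd a≢c a≢d b≢c b≢d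
        P , path , length≡10 , first , last = reverse-square-path
    in P , path , subst (λ ℓ → ℕ→ℚ ℓ ≤ _) (sym length≡10) (ten≤4/γ γ<1/6) , first , last
  (mkℚ (+ 0) _ _) (*<* (+<+ ())) _
  (mkℚ -[1+ _ ] _ _) (*<* ()) _
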